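{- Let $k\ge 4$ and $t\ge 1$ be integers and let $T=T_{k,t}$ be the $(k,t)$-tower with base $V_0=\{v_{0,0},v_{0,1}\}$. For every $A\subseteq V(T)$: if $|A|\ge 2$ then $\rho_{k,T}(A)\ge 2(k+1)(k-2)-2(k-1)$; moreover, if $V_0\subseteq A$ then $\rho_{k,T}(A)\ge 2(k+1)(k-2)$.
   Context: The tower $T_{k,t}$ has vertex set $V_0\cup V_1\cup\dots\cup V_t$ with $V_0=\{v_{0,0},v_{0,1}\}$ and $V_i=\{v_{i,0},\dots,v_{i,k-2}\}$ for $1\le i\le t$; for $1\le i\le t$, $V_i$ induces $K_{k-1}$ minus the edge $v_{i,0}v_{i,1}$, the vertex $v_{i-1,0}$ is adjacent to $v_{i,j}$ for all $0\le j\le (k-2)/2$, and $v_{i-1,1}$ is adjacent to $v_{i,j}$ for all $(k-1)/2\le j\le k-2$; there are no other edges. For a graph $H$ and $A\subseteq V(H)$, the potential is $\rho_{k,H}(A)=(k+1)(k-2)|A|-2(k-1)|E(H[A])|$. -}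

module Defs where

open import Data.Nat using (ℕ; zero; suc; _+_; _*_; _∸_; _≤_; _<_; _≟_; _≤?_)
open import Data.Integer as ℤ using (ℤ; +_; _-_)
open import Data.Product using (_×_; _,_)
open import Data.Sum using (_⊎_)
open import Data.List using (List; []; _∷_; length; filter)
open import Relation.Binary.PropositionalEquality using (_≡_; _≢_)
open import Relation.Nullary using (¬_; Dec; ¬?)
open import Relation.Nullary.Decidable using (_×-dec_; _⊎-dec_)

-- A vertex v_{i,j} of the tower is the pair (i , j) : level i, index j.
Vertex : Set
Vertex = ℕ × ℕ

data InTower (k t : ℕ) : Vertex → Set where
  base  : ∀ {j} → j < 2 → InTower k t (0 , j)
  level : ∀ {i j} → 1 ≤ i → i ≤ t → j < k ∸ 1 → InTower k t (i , j)

Inner : Vertex → Vertex → Set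
Inner (i , j) (i' , j') =
  1 ≤ i × i ≡ i' × j ≢ j' × ¬ ((j ≡ 0 × j' ≡ 1) ⊎ (j ≡ 1 × j' ≡ 0))

-- Edges between V_{i-1} and V_i: v_{i-1,0} ~ v_{i,j} for j ≤ (k-2)/2,
-- v_{i-1,1} ~ v_{i,j} for j ≥ (k-1)/2 (i.e. 2j ≤ k-2, resp. 2j ≥ k-1).
Down : ℕ → Vertex → Vertex → Set
Down k (a , b) (i , j) =
  suc a ≡ i × ((b ≡ 0 × 2 * j ≤ k ∸ 2) ⊎ (b ≡ 1 × k ∸ 1 ≤ 2 * j))

Adj : ℕ → Vertex → Vertex → Set
Adj k u v = Inner u v ⊎ Down k u v ⊎ Down k v u

inner? : ∀ u v → Dec (Inner u v)
inner? (i , j) (i' , j') =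
  (1 ≤? i) ×-dec ((i ≟ i') ×-dec (¬? (j ≟ j') ×-dec
    ¬? (((j ≟ 0) ×-dec (j' ≟ 1)) ⊎-dec ((j ≟ 1) ×-dec (j' ≟ 0)))))

down? : ∀ k u v → Dec (Down k u v)
down? k (a , b) (i , j) =
  (suc a ≟ i) ×-dec (((b ≟ 0) ×-dec (2 * j ≤? k ∸ 2))
                     ⊎-dec ((b ≟ 1) ×-dec (k ∸ 1 ≤? 2 * j)))

adj? : ∀ k u v → Dec (Adj k u v)
adj? k u v = inner? u v ⊎-dec (down? k u v ⊎-dec down? k v u)

-- |E(T[A])| for a duplicate-free list A of vertices: number of unordered
-- adjacent pairs (each pair counted once, at its earlier element).
edgeCount : ℕ → List Vertex → ℕ
edgeCount k [] = 0
edgeCount k (x ∷ xs) = length (filter (adj? k x) xs) + edgeCount k xs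

ρ : ℕ → List Vertex → ℤ
ρ k A = + ((k + 1) * (k ∸ 2) * length A) - + (2 * (k ∸ 1) * edgeCount k A)

-- Write c = (k+1)(k-2) and d = 2(k-1), so that ρ(A) = c|A| - d|E(A)|, and induct on the height
-- of the tower, splitting A into the part A′ below the top level and the part B on it. B lies in
-- a copy of K_{k-1} minus an edge, so it spans at most |B|(|B|-1)/2 edges, one fewer when it
-- contains both ends of the missing edge (as it must when it is the whole level); and each vertex
-- of B has exactly one neighbour below it. Hence d(|E(B)| + e(A′,B)) ≤ c|B|: adding a level never
-- decreases the potential, which gives both bounds as soon as A′ has two vertices. When A′ is
-- empty or a single vertex u, the same edge count finishes the proof, using that the neighbours of
-- u in B all lie on one side of the level (those joined to v_{t-1,0}, or those joined to
-- v_{t-1,1}), so that there are at most about k/2 of them.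
module Submission where

open import Defs
open import Data.Nat using (ℕ; zero; suc; _+_; _*_; _∸_; _≤_; _<_; z≤n; s≤s; _≟_; _≤?_; _<?_)
open import Data.Nat.Properties
open import Data.Nat.DivMod using (_/_; _%_; m≡m%n+[m/n]*n; m%n<n)
open import Data.Nat.Tactic.RingSolver using (solve; solve-∀)
open import Algebra.Properties.CommutativeSemigroup +-commutativeSemigroup using (x∙yz≈y∙xz)
open import Data.Integer as ℤ using (+_; _-_; _⊖_)
import Data.Integer.Properties as ℤ
open import Data.Product as Prod using (_×_; _,_; proj₁; proj₂)
open import Data.Sum as Sum using (_⊎_; inj₁; inj₂)
open import Data.List using (List; []; _∷_; length; filter)
open import Data.List.Properties using (length-filter; filter-none)
open import Data.List.Relation.Unary.All as All using (All)
import Data.List.Relation.Unary.All.Properties as All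
open import Data.List.Relation.Unary.Unique.Propositional using (Unique)
import Data.List.Relation.Unary.Unique.Propositional.Properties as Unique
open import Data.List.Membership.Propositional using (_∈_)
open import Data.List.Membership.Propositional.Properties using (∈-filter⁺)
open import Data.List.Relation.Unary.Any using (here)
open import Data.Empty using (⊥-elim)
open import Function using (_∘_; flip)
open import Relation.Binary.PropositionalEquality
open import Relation.Nullary using (¬_; Dec; yes; no)
open import Relation.Nullary.Decidable using (_×-dec_)
open import Relation.Unary using (Decidable; ∁)
open import Relation.Unary.Properties using (∁?)

-- B ⊆ V_i with a = |B|, E = |E(B)|, z = |B ∩ {v_{i,0}, v_{i,1}}| and w = |V_i| = k - 1; the
-- inequalities avoid subtraction, e.g. 2E + a ≤ a² says E ≤ a(a-1)/2.
record LevelBounds (w a z E : ℕ) : Set where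
  field
    edges≤           : 2 * E + a ≤ a * a
    edges≤-both-ends : z ≡ 2 → 2 * E + a + 2 ≤ a * a
    size≤            : a ≤ w
    full⇒both-ends   : a ≡ w → z ≡ 2

add-independent-vertex : ∀ {E X z a} → 2 * E + z * z + a ≤ a * a + z → X + z ≤ a →
  2 * (X + E) + suc z * suc z + suc a ≤ suc a * suc a + suc z
add-independent-vertex {E} {X} {z} {a} ih X+z≤a = begin
  2 * (X + E) + suc z * suc z + suc a     ≡⟨ solve (E ∷ X ∷ z ∷ a ∷ []) ⟩
  (2 * E + z * z + a) + (2 * (X + z) + 2) ≤⟨ +-mono-≤ ih (+-monoˡ-≤ 2 (*-monoʳ-≤ 2 X+z≤a)) ⟩
  (a * a + z) + (2 * a + 2)               ≡⟨ solve (z ∷ a ∷ []) ⟩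
  suc a * suc a + suc z                   ∎
  where open ≤-Reasoning

add-vertex : ∀ {E X z a} → 2 * E + z * z + a ≤ a * a + z → X ≤ a →
  2 * (X + E) + z * z + suc a ≤ suc a * suc a + z
add-vertex {E} {X} {z} {a} ih X≤a = begin
  2 * (X + E) + z * z + suc a       ≡⟨ solve (E ∷ X ∷ z ∷ a ∷ []) ⟩
  (2 * E + z * z + a) + (2 * X + 1) ≤⟨ +-mono-≤ ih (+-monoˡ-≤ 1 (*-monoʳ-≤ 2 X≤a)) ⟩
  (a * a + z) + (2 * a + 1)         ≡⟨ solve (z ∷ a ∷ []) ⟩
  suc a * suc a + z                 ∎
  where open ≤-Reasoning

edges≤-by-ends : ∀ {E a} z → z ≤ 2 → 2 * E + z * z + a ≤ a * a + z →
  (2 * E + a ≤ a * a) × (z ≡ 2 → 2 * E + a + 2 ≤ a * a)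
edges≤-by-ends {E} {a} 0 _ bound = (begin
  2 * E + a         ≡⟨ solve (E ∷ a ∷ []) ⟩
  2 * E + 0 * 0 + a ≤⟨ bound ⟩
  a * a + 0         ≡⟨ +-identityʳ _ ⟩
  a * a             ∎) , λ ()
  where open ≤-Reasoning
edges≤-by-ends {E} {a} 1 _ bound = +-cancelʳ-≤ 1 _ _ (begin
  2 * E + a + 1     ≡⟨ solve (E ∷ a ∷ []) ⟩
  2 * E + 1 * 1 + a ≤⟨ bound ⟩
  a * a + 1         ∎) , λ ()
  where open ≤-Reasoning
edges≤-by-ends {E} {a} 2 _ bound = ≤-trans (m≤m+n _ 2) missing , λ _ → missing
  where
  open ≤-Reasoning
  missing : 2 * E + a + 2 ≤ a * a
  missing = +-cancelʳ-≤ 2 _ _ (begin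
    2 * E + a + 2 + 2 ≡⟨ solve (E ∷ a ∷ []) ⟩
    2 * E + 2 * 2 + a ≤⟨ bound ⟩
    a * a + 2         ∎)
edges≤-by-ends (suc (suc (suc _))) (s≤s (s≤s ())) _

twice-edges+cross≤ : ∀ {a E X} → 2 * E + a ≤ a * a → X ≤ a → 2 * E + 2 * X ≤ a * suc a
twice-edges+cross≤ {a} {E} {X} E≤ X≤ = +-cancelʳ-≤ a _ _ (begin
  2 * E + 2 * X + a   ≡⟨ solve (a ∷ E ∷ X ∷ []) ⟩
  (2 * E + a) + 2 * X ≤⟨ +-mono-≤ E≤ (*-monoʳ-≤ 2 X≤) ⟩
  a * a + 2 * a       ≡⟨ solve (a ∷ []) ⟩
  a * suc a + a       ∎)
  where open ≤-Reasoning

level-size : ∀ {a z y} w → z ≤ 2 → y ≤ w → z + y ≡ a → a ≤ 2 + w × (a ≡ 2 + w → z ≡ 2)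
level-size {z = z} w z≤2 y≤w refl = +-mono-≤ z≤2 y≤w , λ full → ≤-antisym z≤2
  (+-cancelʳ-≤ w 2 z (subst (_≤ z + w) full (+-monoʳ-≤ z y≤w)))

left-half⇒< : ∀ {n h r j} → n ≡ r + h * 2 → r < 2 → 2 * j ≤ 2 + n → j < 2 + h
left-half⇒< {h = h} {r} {j} refl r<2 2j≤ = ≰⇒> too-big
  where
  open ≤-Reasoning
  too-big : ¬ (2 + h ≤ j)
  too-big 2+h≤j = <⇒≱ r<2 (+-cancelʳ-≤ (2 + h * 2) 2 r (begin
    2 + (2 + h * 2) ≡⟨ solve (h ∷ []) ⟩
    2 * (2 + h)     ≤⟨ *-monoʳ-≤ 2 2+h≤j ⟩
    2 * j           ≤⟨ 2j≤ ⟩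
    2 + (r + h * 2) ≡⟨ solve (r ∷ h ∷ []) ⟩
    r + (2 + h * 2) ∎))

¬left-half⇒≥ : ∀ {n h r j} → n ≡ r + h * 2 → ¬ (2 * j ≤ 2 + n) → 2 + h ≤ j
¬left-half⇒≥ {h = h} {r} {j} refl ¬2j≤ = ≮⇒≥ λ j<2+h → ¬2j≤ (begin
  2 * j           ≤⟨ *-monoʳ-≤ 2 (≤-pred j<2+h) ⟩
  2 * (1 + h)     ≡⟨ solve (h ∷ []) ⟩
  2 + h * 2       ≤⟨ +-monoʳ-≤ 2 (m≤n+m (h * 2) r) ⟩
  2 + (r + h * 2) ∎)
  where open ≤-Reasoning

right-half-index : ∀ {n h r j} → n ≡ r + h * 2 → j < 3 + n → j < (1 + h + r) + (2 + h)
right-half-index {h = h} {r} {j} refl j< = begin-strict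
  j                     <⟨ j< ⟩
  3 + (r + h * 2)       ≡⟨ solve (r ∷ h ∷ []) ⟩
  (1 + h + r) + (2 + h) ∎
  where open ≤-Reasoning

one-side-bounds : ∀ {n h r z X} → n ≡ r + h * 2 → r < 2 → z ≤ 2 → X ≤ z + h ⊎ X ≤ 1 + h + r →
  2 * X ≤ 4 + n × (z ≡ 2 ⊎ X < 2 + n)
one-side-bounds {h = h} {r} {z} {X} refl r<2 z≤2 (inj₁ X≤z+h) =
  twice-bound , both⊎small (m≤n⇒m<n∨m≡n z≤2)
  where
  open ≤-Reasoning
  h≤ : h ≤ r + h * 2
  h≤ = ≤-trans (m≤m*n h 2) (m≤n+m (h * 2) r)
  twice-bound : 2 * X ≤ 4 + (r + h * 2)
  twice-bound = begin
    2 * X           ≤⟨ *-monoʳ-≤ 2 (≤-trans X≤z+h (+-monoˡ-≤ h z≤2)) ⟩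
    2 * (2 + h)     ≡⟨ solve (h ∷ []) ⟩
    4 + h * 2       ≤⟨ +-monoʳ-≤ 4 (m≤n+m (h * 2) r) ⟩
    4 + (r + h * 2) ∎
  both⊎small : z < 2 ⊎ z ≡ 2 → z ≡ 2 ⊎ X < 2 + (r + h * 2)
  both⊎small (inj₂ z≡2) = inj₁ z≡2
  both⊎small (inj₁ (s≤s z≤1)) = inj₂ (s≤s (≤-trans X≤z+h (+-mono-≤ z≤1 h≤)))
one-side-bounds {h = h} {r} {z} {X} refl r<2 z≤2 (inj₂ X≤1+h+r) = twice-bound , inj₂ (begin
    suc X           ≤⟨ s≤s X≤1+h+r ⟩
    2 + h + r       ≡⟨ solve (r ∷ h ∷ []) ⟩
    2 + (r + h)     ≤⟨ +-monoʳ-≤ 2 (+-monoʳ-≤ r (m≤m*n h 2)) ⟩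
    2 + (r + h * 2) ∎)
  where
  open ≤-Reasoning
  twice-bound : 2 * X ≤ 4 + (r + h * 2)
  twice-bound = begin
    2 * X                   ≤⟨ *-monoʳ-≤ 2 X≤1+h+r ⟩
    2 * (1 + h + r)         ≡⟨ solve (r ∷ h ∷ []) ⟩
    (2 + r) + (r + h * 2)   ≤⟨ +-monoˡ-≤ _ (+-monoʳ-≤ 2 (<⇒≤ r<2)) ⟩
    4 + (r + h * 2)         ∎

-- k = n + 3. The ring solver treats c and d as opaque constants, so where it must see through
-- them the chains below spell them out as (3 + n + 1) * (1 + n) and 2 * (2 + n).
module Potential (n : ℕ) where
  k c d : ℕ
  k = 3 + n
  c = (k + 1) * (k ∸ 2)
  d = 2 * (k ∸ 1)

  width²≤c : (2 + n) * (2 + n) ≤ c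
  width²≤c = begin
    (2 + n) * (2 + n)     ≤⟨ m≤m+n _ n ⟩
    (2 + n) * (2 + n) + n ≡⟨ solve (n ∷ []) ⟩
    (3 + n + 1) * (1 + n) ∎
    where open ≤-Reasoning

  level-potential≥0 : ∀ {a z E X} → LevelBounds (2 + n) a z E → X ≤ a → d * (E + X) ≤ c * a
  level-potential≥0 {a} {E = E} {X} lb X≤ with m≤n⇒m<n∨m≡n (LevelBounds.size≤ lb)
  ... | inj₁ a<w = begin
    2 * (2 + n) * (E + X)       ≡⟨ solve (n ∷ E ∷ X ∷ []) ⟩
    (2 + n) * (2 * E + 2 * X)   ≤⟨ *-monoʳ-≤ (2 + n) (twice-edges+cross≤ {E = E} edges≤ X≤) ⟩
    (2 + n) * (a * suc a)       ≤⟨ *-monoʳ-≤ (2 + n) (*-monoʳ-≤ a a<w) ⟩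
    (2 + n) * (a * (2 + n))     ≡⟨ solve (n ∷ a ∷ []) ⟩
    ((2 + n) * (2 + n)) * a     ≤⟨ *-monoˡ-≤ a width²≤c ⟩
    c * a                       ∎
    where open ≤-Reasoning
          open LevelBounds lb
  ... | inj₂ refl = begin
    2 * (2 + n) * (E + X)       ≡⟨ solve (n ∷ E ∷ X ∷ []) ⟩
    (2 + n) * (2 * E + 2 * X)   ≤⟨ *-monoʳ-≤ (2 + n) E+X≤ ⟩
    (2 + n) * c                 ≡⟨ *-comm (2 + n) c ⟩
    c * (2 + n)                 ∎
    where
    open ≤-Reasoning
    open LevelBounds lb
    E+X≤ : 2 * E + 2 * X ≤ c
    E+X≤ = +-cancelʳ-≤ (4 + n) _ _ (begin
      2 * E + 2 * X + (4 + n)         ≡⟨ solve (n ∷ E ∷ X ∷ []) ⟩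
      (2 * E + (2 + n) + 2) + 2 * X   ≤⟨ +-mono-≤ (edges≤-both-ends (full⇒both-ends refl)) (*-monoʳ-≤ 2 X≤) ⟩
      (2 + n) * (2 + n) + 2 * (2 + n) ≡⟨ solve (n ∷ []) ⟩
      (3 + n + 1) * (1 + n) + (4 + n) ∎)

  sparse-potential≥ : ∀ {p T} → 2 ≤ p → p ≤ 2 + n → T + p ≤ p * p →
    (p ≡ 2 + n → T + p + 2 ≤ p * p) → 2 * c + (2 + n) * T ≤ c * p + d
  sparse-potential≥ {suc (suc b)} {T} (s≤s (s≤s _)) p≤w T≤ T≤-full with m≤n⇒m<n∨m≡n p≤w
  ... | inj₁ (s≤s (s≤s 1+b≤n)) = begin
    2 * c + (2 + n) * T                           ≤⟨ +-monoʳ-≤ (2 * c) (*-monoʳ-≤ (2 + n) T≤′) ⟩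
    2 * c + (2 + n) * ((2 + b) * (1 + b))         ≡⟨ cong (λ x → 2 * c + x) (solve (n ∷ b ∷ [])) ⟩
    2 * c + ((2 + n) * (3 + b) * b + 2 * (2 + n)) ≤⟨ +-monoʳ-≤ (2 * c) (+-monoˡ-≤ _ (*-monoˡ-≤ b 3+b≤)) ⟩
    2 * c + ((2 + n) * (2 + n) * b + 2 * (2 + n)) ≤⟨ +-monoʳ-≤ (2 * c) (+-monoˡ-≤ _ (*-monoˡ-≤ b width²≤c)) ⟩
    2 * c + (c * b + 2 * (2 + n))                 ≡⟨ regroup c b _ ⟩
    c * (2 + b) + 2 * (2 + n)                     ∎
    where
    open ≤-Reasoning
    3+b≤ : (2 + n) * (3 + b) ≤ (2 + n) * (2 + n)
    3+b≤ = *-monoʳ-≤ (2 + n) (s≤s (s≤s 1+b≤n))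
    T≤′ : T ≤ (2 + b) * (1 + b)
    T≤′ = +-cancelʳ-≤ (2 + b) _ _ (≤-trans T≤ (≤-reflexive (solve (b ∷ []))))
    regroup : ∀ c b x → 2 * c + (c * b + x) ≡ c * (2 + b) + x
    regroup = solve-∀
  ... | inj₂ refl = +-cancelʳ-≤ ((2 + n) * (4 + n)) _ _ (begin
    2 * c + (2 + n) * T + (2 + n) * (4 + n) ≡⟨ solve (n ∷ T ∷ []) ⟩
    2 * c + (2 + n) * (T + (2 + n) + 2)     ≤⟨ +-monoʳ-≤ (2 * c) (*-monoʳ-≤ (2 + n) (T≤-full refl)) ⟩
    2 * c + (2 + n) * ((2 + n) * (2 + n))   ≤⟨ m≤m+n _ 4 ⟩
    2 * ((3 + n + 1) * (1 + n)) + (2 + n) * ((2 + n) * (2 + n)) + 4 ≡⟨ solve (n ∷ []) ⟩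
    (3 + n + 1) * (1 + n) * (2 + n) + 2 * (2 + n) + (2 + n) * (4 + n) ∎)
    where open ≤-Reasoning

  lone-level-potential≥ : ∀ {a z E} → LevelBounds (2 + n) a z E → 2 ≤ a → 2 * c + d * E ≤ c * a + d
  lone-level-potential≥ {a} {E = E} lb a≥2 = begin
    2 * c + 2 * (2 + n) * E   ≡⟨ cong (λ x → 2 * c + x) (solve (n ∷ E ∷ [])) ⟩
    2 * c + (2 + n) * (2 * E) ≤⟨ sparse-potential≥ a≥2 size≤ edges≤ (edges≤-both-ends ∘ full⇒both-ends) ⟩
    c * a + d                 ∎
    where open ≤-Reasoning
          open LevelBounds lb

  level-over-vertex-potential≥ : ∀ {a z E X} → LevelBounds (2 + n) a z E → 1 ≤ a → X ≤ a → 2 * X ≤ k →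
    z ≡ 2 ⊎ X < 1 + n → 2 * c + d * (E + X) ≤ c * suc a + d
  level-over-vertex-potential≥ {a} {z} {E} {X} lb a≥1 X≤a 2X≤k both⊎X<
    with m≤n⇒m<n∨m≡n (LevelBounds.size≤ lb)
  ... | inj₁ (s≤s a≤1+n) = begin
    2 * c + 2 * (2 + n) * (E + X)     ≡⟨ cong (λ x → 2 * c + x) (solve (n ∷ E ∷ X ∷ [])) ⟩
    2 * c + (2 + n) * (2 * E + 2 * X) ≤⟨ sparse-potential≥ (s≤s a≥1) (s≤s a≤1+n) T≤ (T≤-full both⊎X<) ⟩
    c * suc a + d                     ∎
    where
    open ≤-Reasoning
    open LevelBounds lb
    T≤ : 2 * E + 2 * X + suc a ≤ suc a * suc a
    T≤ = begin
      2 * E + 2 * X + suc a   ≡⟨ solve (a ∷ E ∷ X ∷ []) ⟩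
      suc (2 * E + 2 * X + a) ≤⟨ s≤s (+-monoˡ-≤ a (twice-edges+cross≤ {E = E} edges≤ X≤a)) ⟩
      suc (a * suc a + a)     ≡⟨ solve (a ∷ []) ⟩
      suc a * suc a           ∎
    T≤-full : z ≡ 2 ⊎ X < 1 + n → suc a ≡ 2 + n → 2 * E + 2 * X + suc a + 2 ≤ suc a * suc a
    T≤-full (inj₁ both-ends) refl = begin
      2 * E + 2 * X + suc a + 2   ≡⟨ solve (n ∷ E ∷ X ∷ []) ⟩
      (2 * E + a + 2) + 2 * X + 1 ≤⟨ +-monoˡ-≤ 1 (+-mono-≤ (edges≤-both-ends both-ends) (*-monoʳ-≤ 2 X≤a)) ⟩
      a * a + 2 * a + 1           ≡⟨ solve (n ∷ []) ⟩
      suc a * suc a               ∎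
    T≤-full (inj₂ X<a) refl = begin
      2 * E + 2 * X + suc a + 2   ≡⟨ solve (n ∷ E ∷ X ∷ []) ⟩
      (2 * E + a) + 2 * suc X + 1 ≤⟨ +-monoˡ-≤ 1 (+-mono-≤ edges≤ (*-monoʳ-≤ 2 X<a)) ⟩
      a * a + 2 * a + 1           ≡⟨ solve (n ∷ []) ⟩
      suc a * suc a               ∎
  ... | inj₂ refl = +-cancelʳ-≤ ((2 + n) * (4 + n)) _ _ (begin
    2 * c + 2 * (2 + n) * (E + X) + (2 + n) * (4 + n) ≡⟨ solve (n ∷ E ∷ X ∷ []) ⟩
    2 * c + (2 + n) * ((2 * E + (2 + n) + 2) + 2 * X) ≤⟨ +-monoʳ-≤ (2 * c) (*-monoʳ-≤ (2 + n) T≤) ⟩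
    2 * c + (2 + n) * ((2 + n) * (2 + n) + (3 + n))   ≤⟨ m≤m+n _ 2 ⟩
    2 * ((3 + n + 1) * (1 + n)) + (2 + n) * ((2 + n) * (2 + n) + (3 + n)) + 2 ≡⟨ solve (n ∷ []) ⟩
    (3 + n + 1) * (1 + n) * (3 + n) + 2 * (2 + n) + (2 + n) * (4 + n) ∎)
    where
    open ≤-Reasoning
    open LevelBounds lb
    T≤ : (2 * E + (2 + n) + 2) + 2 * X ≤ (2 + n) * (2 + n) + (3 + n)
    T≤ = +-mono-≤ (edges≤-both-ends (full⇒both-ends refl)) 2X≤k

  add-level : ∀ {L E a EB X r} → 2 * c + d * E ≤ c * L + r → d * (EB + X) ≤ c * a →
    2 * c + d * (E + EB + X) ≤ c * (L + a) + r
  add-level {L} {E} {a} {EB} {X} {r} lower upper = begin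
    2 * c + d * (E + EB + X)       ≡⟨ regroup₁ c d E EB X ⟩
    (2 * c + d * E) + d * (EB + X) ≤⟨ +-mono-≤ lower upper ⟩
    (c * L + r) + c * a            ≡⟨ regroup₂ c L a r ⟩
    c * (L + a) + r                ∎
    where
    open ≤-Reasoning
    regroup₁ : ∀ c d E EB X → 2 * c + d * (E + EB + X) ≡ (2 * c + d * E) + d * (EB + X)
    regroup₁ = solve-∀
    regroup₂ : ∀ c L a r → (c * L + r) + c * a ≡ c * (L + a) + r
    regroup₂ = solve-∀

m+q≤p+n⇒m-n≤p-q : ∀ {m n p q} → m + q ≤ p + n → + m - + n ℤ.≤ + p - + q
m+q≤p+n⇒m-n≤p-q {m} {n} {p} {q} m+q≤p+n = begin
  + m - + n         ≡⟨ ℤ.m-n≡m⊖n m n ⟩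
  m ⊖ n             ≡⟨ ℤ.+-cancelˡ-⊖ q m n ⟨
  (q + m) ⊖ (q + n) ≤⟨ ℤ.⊖-monoˡ-≤ (q + n) (subst₂ _≤_ (+-comm m q) (+-comm p n) m+q≤p+n) ⟩
  (n + p) ⊖ (q + n) ≡⟨ cong ((n + p) ⊖_) (+-comm q n) ⟩
  (n + p) ⊖ (n + q) ≡⟨ ℤ.+-cancelˡ-⊖ n p q ⟩
  p ⊖ q             ≡⟨ ℤ.m-n≡m⊖n p q ⟨
  + p - + q         ∎
  where open ℤ.≤-Reasoning

-- Opened only from here on: with these overloaded constructors in scope, elaborating the
-- variable lists passed to the ring solver above becomes prohibitively slow.
open import Data.List.Relation.Unary.All using ([]; _∷_)
open import Data.List.Relation.Unary.AllPairs using ([]; _∷_)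

module _ {A : Set} {P : A → Set} (P? : Decidable P) where

  count-∁ : ∀ xs → length (filter P? xs) + length (filter (∁? P?) xs) ≡ length xs
  count-∁ [] = refl
  count-∁ (x ∷ xs) with P? x
  ... | yes _ = cong suc (count-∁ xs)
  ... | no _ = trans (+-suc _ _) (cong suc (count-∁ xs))

  count-none : ∀ {xs} → All (∁ P) xs → length (filter P? xs) ≡ 0
  count-none ¬P = cong length (filter-none P? ¬P)

  count-≤1 : ∀ {w xs} → Unique xs → All (λ x → P x → x ≡ w) xs → length (filter P? xs) ≤ 1
  count-≤1 [] [] = z≤n
  count-≤1 {xs = x ∷ xs} (x∉xs ∷ unique) (x≡w ∷ ≡w) with P? x
  ... | no _ = count-≤1 unique ≡w
  ... | yes Px = ≤-reflexive (cong suc (count-none (All.zipWith only-x (x∉xs , ≡w))))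
    where
    only-x : ∀ {y} → x ≢ y × (P y → y ≡ _) → ¬ P y
    only-x (x≢y , y≡w) Py = x≢y (trans (x≡w Px) (sym (y≡w Py)))

  count-filter : ∀ {S : A → Set} (S? : Decidable S) xs →
    length (filter P? xs) ≡ length (filter P? (filter S? xs)) + length (filter P? (filter (∁? S?) xs))
  count-filter S? [] = refl
  count-filter S? (x ∷ xs) with S? x
  ... | yes _ with P? x
  ...   | yes _ = cong suc (count-filter S? xs)
  ...   | no _ = count-filter S? xs
  count-filter S? (x ∷ xs) | no _ with P? x
  ...   | yes _ = trans (cong suc (count-filter S? xs)) (sym (+-suc _ _))
  ...   | no _ = count-filter S? xs

count-mono : ∀ {A : Set} {P Q : A → Set} (P? : Decidable P) (Q? : Decidable Q) {xs} →
  All (λ x → P x → Q x) xs → length (filter P? xs) ≤ length (filter Q? xs)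
count-mono P? Q? [] = z≤n
count-mono P? Q? {x ∷ _} (P⇒Q ∷ hs) with P? x | Q? x
... | yes _ | yes _ = s≤s (count-mono P? Q? hs)
... | yes Px | no ¬Qx = ⊥-elim (¬Qx (P⇒Q Px))
... | no _ | yes _ = m≤n⇒m≤1+n (count-mono P? Q? hs)
... | no _ | no _ = count-mono P? Q? hs

count-interval : ∀ {A : Set} {P : A × ℕ → Set} (P? : Decidable P) {s} lo n {xs} →
  Unique xs → All (λ v → proj₁ v ≡ s) xs → All (λ v → P v → lo ≤ proj₂ v × proj₂ v < n + lo) xs →
  length (filter P? xs) ≤ n
count-interval P? lo zero _ _ inside =
  ≤-reflexive (count-none P? (All.map (λ bounds → (λ (lo≤j , j<lo) → ≤⇒≯ lo≤j j<lo) ∘ bounds) inside))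
count-interval {P = P} P? {s} lo (suc n) {xs} unique on-s inside = begin
  length (filter P? xs)                                         ≡⟨ count-filter P? top? xs ⟩
  length (filter P? (filter top? xs)) + length (filter P? rest) ≤⟨ +-mono-≤ at-top below-top ⟩
  1 + n                                                         ∎
  where
  open ≤-Reasoning
  top? : Decidable (λ v → proj₂ v ≡ n + lo)
  top? v = proj₂ v ≟ n + lo
  rest = filter (∁? top?) xs
  at-top = ≤-trans (length-filter P? (filter top? xs))
                   (count-≤1 top? unique (All.map (λ { {i , j} refl refl → refl }) on-s))
  below-top = count-interval P? lo n (Unique.filter⁺ (∁? top?) unique) (All.filter⁺ (∁? top?) on-s)
    (All.zipWith narrow (All.filter⁺ (∁? top?) inside , All.all-filter (∁? top?) xs))
    where
    narrow : ∀ {v} → (P v → lo ≤ proj₂ v × proj₂ v < suc n + lo) × proj₂ v ≢ n + lo →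
             P v → lo ≤ proj₂ v × proj₂ v < n + lo
    narrow (bounds , ≢top) Pv with bounds Pv
    ... | lo≤j , j<top with m<1+n⇒m<n∨m≡n j<top
    ...   | inj₁ j<n+lo = lo≤j , j<n+lo
    ...   | inj₂ j≡n+lo = ⊥-elim (≢top j≡n+lo)

module _ {A : Set} {_~_ : A → A → Set} (_~?_ : ∀ x → Decidable (x ~_)) where

  pairCount : List A → ℕ
  pairCount [] = 0
  pairCount (x ∷ xs) = length (filter (x ~?_) xs) + pairCount xs

  crossCount : List A → List A → ℕ
  crossCount [] ys = 0
  crossCount (x ∷ xs) ys = length (filter (x ~?_) ys) + crossCount xs ys

  crossCount-[]ʳ : ∀ xs → crossCount xs [] ≡ 0
  crossCount-[]ʳ [] = refl
  crossCount-[]ʳ (x ∷ xs) = crossCount-[]ʳ xs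

  module _ (sym~ : ∀ {x y} → x ~ y → y ~ x) where

    crossCount-∷ʳ : ∀ xs y ys → crossCount xs (y ∷ ys) ≡ length (filter (y ~?_) xs) + crossCount xs ys
    crossCount-∷ʳ [] y ys = refl
    crossCount-∷ʳ (x ∷ xs) y ys with x ~? y | y ~? x
    ... | yes _ | yes _ =
      cong suc (trans (cong (λ m → _ + m) (crossCount-∷ʳ xs y ys)) (x∙yz≈y∙xz Nx Ny _))
      where Nx = length (filter (x ~?_) ys); Ny = length (filter (y ~?_) xs)
    ... | yes x~y | no y≁x = ⊥-elim (y≁x (sym~ x~y))
    ... | no x≁y | yes y~x = ⊥-elim (x≁y (sym~ y~x))
    ... | no _ | no _ = trans (cong (λ m → _ + m) (crossCount-∷ʳ xs y ys)) (x∙yz≈y∙xz Nx Ny _)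
      where Nx = length (filter (x ~?_) ys); Ny = length (filter (y ~?_) xs)

    pairCount-split : ∀ {S : A → Set} (S? : Decidable S) xs →
      pairCount xs ≡ pairCount (filter S? xs) + pairCount (filter (∁? S?) xs)
                     + crossCount (filter S? xs) (filter (∁? S?) xs)
    pairCount-split S? [] = refl
    pairCount-split S? (x ∷ xs) with S? x
    ... | yes _ = begin
      N xs + pairCount xs
        ≡⟨ cong₂ _+_ (count-filter (x ~?_) S? xs) (pairCount-split S? xs) ⟩
      (N ins + N outs) + (pairCount ins + pairCount outs + crossCount ins outs)
        ≡⟨ regroup (N ins) (N outs) (pairCount ins) (pairCount outs) (crossCount ins outs) ⟩
      (N ins + pairCount ins) + pairCount outs + (N outs + crossCount ins outs) ∎
      where
      open ≡-Reasoning
      N = λ ys → length (filter (x ~?_) ys)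
      ins = filter S? xs
      outs = filter (∁? S?) xs
      regroup : ∀ a b c d e → (a + b) + (c + d + e) ≡ (a + c) + d + (b + e)
      regroup = solve-∀
    ... | no _ = begin
      N xs + pairCount xs
        ≡⟨ cong₂ _+_ (count-filter (x ~?_) S? xs) (pairCount-split S? xs) ⟩
      (N ins + N outs) + (pairCount ins + pairCount outs + crossCount ins outs)
        ≡⟨ regroup (N ins) (N outs) (pairCount ins) (pairCount outs) (crossCount ins outs) ⟩
      pairCount ins + (N outs + pairCount outs) + (N ins + crossCount ins outs)
        ≡⟨ cong (λ m → pairCount ins + (N outs + pairCount outs) + m) (crossCount-∷ʳ ins x outs) ⟨
      pairCount ins + (N outs + pairCount outs) + crossCount ins (x ∷ outs) ∎
      where
      open ≡-Reasoning
      N = λ ys → length (filter (x ~?_) ys)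
      ins = filter S? xs
      outs = filter (∁? S?) xs
      regroup : ∀ a b c d e → (a + b) + (c + d + e) ≡ c + (b + d) + (a + e)
      regroup = solve-∀

  -- At most C(a,2) - C(z,2) pairs when z of the a elements are pairwise unrelated.
  independent-pairs : ∀ {Z : A → Set} (Z? : Decidable Z) → (∀ {u v} → Z u → Z v → ¬ u ~ v) →
    ∀ xs → let a = length xs; z = length (filter Z? xs) in 2 * pairCount xs + z * z + a ≤ a * a + z
  independent-pairs Z? indep [] = z≤n
  independent-pairs Z? indep (x ∷ xs) with Z? x
  ... | yes Zx = add-independent-vertex (independent-pairs Z? indep xs) (begin
    length (filter (x ~?_) xs) + z
      ≤⟨ +-monoˡ-≤ z (count-mono (x ~?_) (∁? Z?) {xs} (All.tabulate (λ _ → flip (indep Zx)))) ⟩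
    length (filter (∁? Z?) xs) + z ≡⟨ +-comm _ z ⟩
    z + length (filter (∁? Z?) xs) ≡⟨ count-∁ Z? xs ⟩
    length xs                      ∎)
    where
    open ≤-Reasoning
    z = length (filter Z? xs)
  ... | no _ = add-vertex (independent-pairs Z? indep xs) (length-filter (x ~?_) xs)

  pairCount-≡0 : ∀ {P : A → Set} → (∀ {u v} → P u → P v → ¬ u ~ v) → ∀ {xs} → All P xs → pairCount xs ≡ 0
  pairCount-≡0 indep [] = refl
  pairCount-≡0 indep {x ∷ _} (Px ∷ Pxs) =
    cong₂ _+_ (count-none (x ~?_) (All.map (indep Px) Pxs)) (pairCount-≡0 indep Pxs)

distinct-members⇒2≤length : ∀ {A : Set} {x y : A} {xs} → x ∈ xs → y ∈ xs → x ≢ y → 2 ≤ length xs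
distinct-members⇒2≤length {xs = _ ∷ _ ∷ _} _ _ _ = s≤s (s≤s z≤n)
distinct-members⇒2≤length {xs = _ ∷ []} (here refl) (here refl) x≢y = ⊥-elim (x≢y refl)

adj-sym : ∀ k {u v} → Adj k u v → Adj k v u
adj-sym k (inj₁ (1≤i , refl , j≢j′ , ¬missing)) =
  inj₁ (1≤i , refl , j≢j′ ∘ sym , ¬missing ∘ Sum.swap ∘ Sum.map Prod.swap Prod.swap)
adj-sym k (inj₂ (inj₁ down)) = inj₂ (inj₂ down)
adj-sym k (inj₂ (inj₂ up)) = inj₂ (inj₁ up)

edgeCount≡pairCount : ∀ k xs → edgeCount k xs ≡ pairCount (adj? k) xs
edgeCount≡pairCount k [] = refl
edgeCount≡pairCount k (x ∷ xs) = cong (λ m → length (filter (adj? k x) xs) + m) (edgeCount≡pairCount k xs)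

MissingEnd : ℕ → Vertex → Set
MissingEnd s v = proj₁ v ≡ s × proj₂ v < 2

missingEnd? : ∀ s → Decidable (MissingEnd s)
missingEnd? s v = (proj₁ v ≟ s) ×-dec (proj₂ v <? 2)

missingEnds≤2 : ∀ {s B} → Unique B → All (λ v → proj₁ v ≡ s) B → length (filter (missingEnd? s) B) ≤ 2
missingEnds≤2 {s} unique on-s =
  count-interval (missingEnd? s) 0 2 unique on-s (All.tabulate (λ _ (_ , j<2) → z≤n , j<2))

distinct-ends : ∀ {j j′} → j < 2 → j′ < 2 → j ≢ j′ → (j ≡ 0 × j′ ≡ 1) ⊎ (j ≡ 1 × j′ ≡ 0)
distinct-ends {0} {0} _ _ 0≢0 = ⊥-elim (0≢0 refl)
distinct-ends {0} {1} _ _ _ = inj₁ (refl , refl)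
distinct-ends {1} {0} _ _ _ = inj₂ (refl , refl)
distinct-ends {1} {1} _ _ 1≢1 = ⊥-elim (1≢1 refl)
distinct-ends {suc (suc _)} (s≤s (s≤s ())) _ _
distinct-ends {_} {suc (suc _)} _ (s≤s (s≤s ())) _

missing-edge : ∀ k {s u v} → MissingEnd s u → MissingEnd s v → ¬ Adj k u v
missing-edge k (refl , j<2) (refl , j′<2) (inj₁ (_ , _ , j≢j′ , ¬missing)) =
  ¬missing (distinct-ends j<2 j′<2 j≢j′)
missing-edge k (refl , _) (refl , _) (inj₂ (inj₁ (1+i≡i , _))) = 1+n≢n 1+i≡i
missing-edge k (refl , _) (refl , _) (inj₂ (inj₂ (1+i≡i , _))) = 1+n≢n 1+i≡i

adj-up : ∀ k {t u y} → proj₁ u ≤ t → proj₁ y ≡ suc t → Adj k u y → Down k u y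
adj-up k {t} u≤t refl (inj₁ (_ , refl , _)) = ⊥-elim (1+n≰n u≤t)
adj-up k u≤t refl (inj₂ (inj₁ down)) = down
adj-up k {t} u≤t refl (inj₂ (inj₂ (refl , _))) = ⊥-elim (1+n≰n (≤-trans (n≤1+n (suc t)) u≤t))

-- Towers with k = n + 4.
module Tower (n : ℕ) where

  open Potential (suc n) public

  Below : ℕ → Vertex → Set
  Below t v = proj₁ v ≤ t

  below? : ∀ t → Decidable (Below t)
  below? t v = proj₁ v ≤? t

  OnLevel : ℕ → Vertex → Set
  OnLevel s v = proj₁ v ≡ s × proj₂ v < k ∸ 1

  -- The vertices v_{i,j} joined to v_{i-1,0}; the others are joined to v_{i-1,1}.
  LeftHalf : Vertex → Set
  LeftHalf v = 2 * proj₂ v ≤ k ∸ 2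

  leftHalf? : Decidable LeftHalf
  leftHalf? v = 2 * proj₂ v ≤? k ∸ 2

  parent : Vertex → Vertex
  parent (i , j) with 2 * j ≤? k ∸ 2
  ... | yes _ = (i ∸ 1 , 0)
  ... | no _ = (i ∸ 1 , 1)

  down⇒parent : ∀ {u y} → Down k u y → u ≡ parent y
  down⇒parent {_ , _} {_ , j} (refl , inj₁ (refl , 2j≤)) with 2 * j ≤? k ∸ 2
  ... | yes _ = refl
  ... | no 2j≰ = ⊥-elim (2j≰ 2j≤)
  down⇒parent {_ , _} {_ , j} (refl , inj₂ (refl , ≤2j)) with 2 * j ≤? k ∸ 2
  ... | yes 2j≤ = ⊥-elim (1+n≰n (≤-trans ≤2j 2j≤))
  ... | no _ = refl

  crossCount≤length : ∀ {t xs ys} → Unique xs → All (Below t) xs → All (λ y → proj₁ y ≡ suc t) ys →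
    crossCount (adj? k) xs ys ≤ length ys
  crossCount≤length {xs = xs} _ _ [] = ≤-reflexive (crossCount-[]ʳ (adj? k) xs)
  crossCount≤length {xs = xs} {y ∷ ys} unique below (y-above ∷ above) = begin
    crossCount (adj? k) xs (y ∷ ys)                           ≡⟨ crossCount-∷ʳ (adj? k) (adj-sym k) xs y ys ⟩
    length (filter (adj? k y) xs) + crossCount (adj? k) xs ys
      ≤⟨ +-mono-≤ one-parent (crossCount≤length unique below above) ⟩
    1 + length ys                                             ∎
    where
    open ≤-Reasoning
    one-parent : length (filter (adj? k y) xs) ≤ 1
    one-parent = count-≤1 (adj? k y) {parent y} unique
      (All.map (λ u≤t y~u → down⇒parent (adj-up k u≤t y-above (adj-sym k y~u))) below)

  neighbours-on-one-side : ∀ {t u ys} → Below t u → All (λ y → proj₁ y ≡ suc t) ys →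
    let X = length (filter (adj? k u) ys) in
    X ≤ length (filter leftHalf? ys) ⊎ X ≤ length (filter (∁? leftHalf?) ys)
  neighbours-on-one-side {u = a , b} {ys} a≤t above = by-side (b ≟ 0)
    where
    neighbours⊆ : ∀ {Q : Vertex → Set} (Q? : Decidable Q) → (∀ {y} → Down k (a , b) y → Q y) →
      length (filter (adj? k (a , b)) ys) ≤ length (filter Q? ys)
    neighbours⊆ Q? down⇒Q =
      count-mono (adj? k (a , b)) Q? (All.map (λ y-above → down⇒Q ∘ adj-up k a≤t y-above) above)
    by-side : Dec (b ≡ 0) → _
    by-side (yes refl) = inj₁ (neighbours⊆ leftHalf? λ { (_ , inj₁ (_ , 2j≤)) → 2j≤ ; (_ , inj₂ (() , _)) })
    by-side (no b≢0) = inj₂ (neighbours⊆ (∁? leftHalf?) λ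
      { (_ , inj₁ (b≡0 , _)) → ⊥-elim (b≢0 b≡0) ; (_ , inj₂ (_ , ≤2j)) 2j≤ → 1+n≰n (≤-trans ≤2j 2j≤) })

  level-bounds : ∀ {s B} → Unique B → All (OnLevel s) B →
    LevelBounds (k ∸ 1) (length B) (length (filter (missingEnd? s) B)) (pairCount (adj? k) B)
  level-bounds {s} {B} unique on-level = record
    { edges≤ = proj₁ edges ; edges≤-both-ends = proj₂ edges
    ; size≤ = proj₁ size ; full⇒both-ends = proj₂ size }
    where
    ends≤2 = missingEnds≤2 unique (All.map proj₁ on-level)
    others≤ : length (filter (∁? (missingEnd? s)) B) ≤ suc n
    others≤ = count-interval (∁? (missingEnd? s)) 2 (suc n) unique (All.map proj₁ on-level)
      (All.map (λ (on-s , j<) ¬end → ≮⇒≥ (¬end ∘ (on-s ,_)) , ≤-trans j< (≤-reflexive (cong suc (+-comm 2 n))))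
               on-level)
    size = level-size {length B} (suc n) ends≤2 others≤ (count-∁ (missingEnd? s) B)
    edges = edges≤-by-ends {pairCount (adj? k) B} {length B} _ ends≤2
              (independent-pairs (adj? k) (missingEnd? s) (missing-edge k) B)

  upper-neighbour-bounds : ∀ {t u B} → Below t u → Unique B → All (OnLevel (suc t)) B →
    let X = length (filter (adj? k u) B); z = length (filter (missingEnd? (suc t)) B) in
    2 * X ≤ k × (z ≡ 2 ⊎ X < 2 + n)
  -- With n = 2h + r, the left half of a level is {0, …, h+1} and the right half {h+2, …, 2h+r+2}.
  upper-neighbour-bounds {t} {u} {B} u≤t unique on-level =
    one-side-bounds n≡ r<2 ends≤2
      (Sum.map (λ X≤ℓ → ≤-trans X≤ℓ left≤) (λ X≤p → ≤-trans X≤p right≤) (neighbours-on-one-side u≤t on-s))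
    where
    open ≤-Reasoning
    h = n / 2
    r = n % 2
    n≡ : n ≡ r + h * 2
    n≡ = m≡m%n+[m/n]*n n 2
    r<2 : r < 2
    r<2 = m%n<n n 2
    on-s = All.map proj₁ on-level
    end? = missingEnd? (suc t)
    ends≤2 = missingEnds≤2 unique on-s
    middle≤ : length (filter leftHalf? (filter (∁? end?) B)) ≤ h
    middle≤ = count-interval leftHalf? 2 h (Unique.filter⁺ (∁? end?) unique) (All.filter⁺ (∁? end?) on-s)
      (All.zipWith (λ (on-s , ¬end) left → ≮⇒≥ (¬end ∘ (on-s ,_)) ,
                                            ≤-trans (left-half⇒< n≡ r<2 left) (≤-reflexive (+-comm 2 h)))
                   (All.filter⁺ (∁? end?) on-s , All.all-filter (∁? end?) B))
    left≤ : length (filter leftHalf? B) ≤ length (filter end? B) + h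
    left≤ = begin
      length (filter leftHalf? B)
        ≡⟨ count-filter leftHalf? end? B ⟩
      length (filter leftHalf? (filter end? B)) + length (filter leftHalf? (filter (∁? end?) B))
        ≤⟨ +-mono-≤ (length-filter leftHalf? (filter end? B)) middle≤ ⟩
      length (filter end? B) + h
        ∎
    right≤ : length (filter (∁? leftHalf?) B) ≤ 1 + h + r
    right≤ = count-interval (∁? leftHalf?) (2 + h) (1 + h + r) unique on-s
      (All.map (λ (_ , j<) ¬left → ¬left-half⇒≥ n≡ ¬left , right-half-index n≡ j<) on-level)

  -- ρ(A) ≥ 2c - d and ρ(A) ≥ 2c, with the negative terms moved across.
  PotentialBounds : ℕ → Set
  PotentialBounds t = ∀ A → Unique A → All (InTower k t) A →
    (2 ≤ length A → 2 * c + d * pairCount (adj? k) A ≤ c * length A + d) ×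
    ((0 , 0) ∈ A → (0 , 1) ∈ A → 2 * c + d * pairCount (adj? k) A ≤ c * length A)

  ground-independent : ∀ {u v} → InTower k 0 u → InTower k 0 v → ¬ Adj k u v
  ground-independent (base _) (base _) (inj₁ (() , _))
  ground-independent (base _) (base _) (inj₂ (inj₁ (() , _)))
  ground-independent (base _) (base _) (inj₂ (inj₂ (() , _)))
  ground-independent (level (s≤s _) () _) _ _
  ground-independent (base _) (level (s≤s _) () _) _

  bounds-ground : PotentialBounds 0
  bounds-ground A _ A∈T = (λ 2≤A → ≤-trans (two-vertices 2≤A) (m≤m+n _ d)) ,
                          (λ v₀ v₁ → two-vertices (distinct-members⇒2≤length v₀ v₁ λ ()))
    where
    open ≤-Reasoning
    no-edges = pairCount-≡0 (adj? k) ground-independent A∈T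
    two-vertices : 2 ≤ length A → 2 * c + d * pairCount (adj? k) A ≤ c * length A
    two-vertices 2≤A = begin
      2 * c + d * pairCount (adj? k) A ≡⟨ cong (λ e → 2 * c + d * e) no-edges ⟩
      2 * c + d * 0                    ≡⟨ cong (λ x → 2 * c + x) (*-zeroʳ d) ⟩
      2 * c + 0                        ≡⟨ +-identityʳ _ ⟩
      2 * c                            ≡⟨ *-comm 2 c ⟩
      c * 2                            ≤⟨ *-monoʳ-≤ c 2≤A ⟩
      c * length A                     ∎

  lower-levels : ∀ t {A} → All (InTower k (suc t)) A → All (InTower k t) (filter (below? t) A)
  lower-levels t {A} A∈T =
    All.zipWith lower (All.filter⁺ (below? t) A∈T , All.all-filter (below? t) A)
    where
    lower : ∀ {v} → InTower k (suc t) v × Below t v → InTower k t v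
    lower (base j<2 , _) = base j<2
    lower (level 1≤i _ j< , i≤t) = level 1≤i i≤t j<

  top-level : ∀ t {A} → All (InTower k (suc t)) A → All (OnLevel (suc t)) (filter (∁? (below? t)) A)
  top-level t {A} A∈T =
    All.zipWith top (All.filter⁺ (∁? (below? t)) A∈T , All.all-filter (∁? (below? t)) A)
    where
    top : ∀ {v} → InTower k (suc t) v × ¬ Below t v → OnLevel (suc t) v
    top (base _ , ¬0≤t) = ⊥-elim (¬0≤t z≤n)
    top (level _ i≤1+t j< , ¬i≤t) = ≤-antisym i≤1+t (≰⇒> ¬i≤t) , j<

  top-level-potential≥0 : ∀ {t xs B} → Unique xs → All (Below t) xs → Unique B → All (OnLevel (suc t)) B →
    d * (pairCount (adj? k) B + crossCount (adj? k) xs B) ≤ c * length B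
  top-level-potential≥0 unique below uniqueB on-top =
    level-potential≥0 (level-bounds uniqueB on-top) (crossCount≤length unique below (All.map proj₁ on-top))

  stacked-potential≥ : ∀ {t} → PotentialBounds t → ∀ {B} → Unique B → All (OnLevel (suc t)) B →
    ∀ xs → Unique xs → All (InTower k t) xs → All (Below t) xs → 2 ≤ length xs + length B →
    2 * c + d * (pairCount (adj? k) xs + pairCount (adj? k) B + crossCount (adj? k) xs B)
      ≤ c * (length xs + length B) + d
  stacked-potential≥ _ {B} uniqueB on-top [] _ _ _ 2≤a = begin
    2 * c + d * (E + 0) ≡⟨ cong (λ e → 2 * c + d * e) (+-identityʳ E) ⟩
    2 * c + d * E       ≤⟨ lone-level-potential≥ (level-bounds uniqueB on-top) 2≤a ⟩
    c * length B + d    ∎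
    where
    open ≤-Reasoning
    E = pairCount (adj? k) B
  stacked-potential≥ _ {B} uniqueB on-top (u ∷ []) _ _ (u≤t ∷ []) (s≤s 1≤a) = begin
    2 * c + d * (E + (Xu + 0)) ≡⟨ cong (λ x → 2 * c + d * (E + x)) (+-identityʳ Xu) ⟩
    2 * c + d * (E + Xu)       ≤⟨ level-over-vertex-potential≥ (level-bounds uniqueB on-top) 1≤a
                                    (length-filter (adj? k u) B) (proj₁ sides) (proj₂ sides) ⟩
    c * suc (length B) + d     ∎
    where
    open ≤-Reasoning
    E = pairCount (adj? k) B
    Xu = length (filter (adj? k u) B)
    sides = upper-neighbour-bounds u≤t uniqueB on-top
  stacked-potential≥ ih {B} uniqueB on-top xs@(_ ∷ _ ∷ _) unique xs∈T below _ =
    add-level {length xs} {pairCount (adj? k) xs} {length B} {pairCount (adj? k) B} {crossCount (adj? k) xs B}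
      (proj₁ (ih xs unique xs∈T) (s≤s (s≤s z≤n))) (top-level-potential≥0 unique below uniqueB on-top)

  bounds-step : ∀ t → PotentialBounds t → PotentialBounds (suc t)
  bounds-step t ih A unique A∈T = many , ground-pair
    where
    open ≤-Reasoning
    A′ = filter (below? t) A
    B = filter (∁? (below? t)) A
    E = pairCount (adj? k)
    X = crossCount (adj? k)
    unique′ = Unique.filter⁺ (below? t) unique
    uniqueB = Unique.filter⁺ (∁? (below? t)) unique
    A′-below = All.all-filter (below? t) A
    edges : E A ≡ E A′ + E B + X A′ B
    edges = pairCount-split (adj? k) (adj-sym k) (below? t) A
    size : length A ≡ length A′ + length B
    size = sym (count-∁ (below? t) A)
    many : 2 ≤ length A → 2 * c + d * E A ≤ c * length A + d
    many 2≤A = begin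
      2 * c + d * E A                   ≡⟨ cong (λ e → 2 * c + d * e) edges ⟩
      2 * c + d * (E A′ + E B + X A′ B) ≤⟨ stacked-potential≥ ih uniqueB (top-level t A∈T) A′ unique′
                                             (lower-levels t A∈T) A′-below (subst (2 ≤_) size 2≤A) ⟩
      c * (length A′ + length B) + d    ≡⟨ cong (λ l → c * l + d) size ⟨
      c * length A + d                  ∎
    ground-pair : (0 , 0) ∈ A → (0 , 1) ∈ A → 2 * c + d * E A ≤ c * length A
    ground-pair v₀ v₁ = begin
      2 * c + d * E A                   ≡⟨ cong (λ e → 2 * c + d * e) edges ⟩
      2 * c + d * (E A′ + E B + X A′ B) ≤⟨ add-level {length A′} {E A′} {length B} {E B} {X A′ B} lower
                                             (top-level-potential≥0 unique′ A′-below uniqueB (top-level t A∈T)) ⟩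
      c * (length A′ + length B) + 0    ≡⟨ +-identityʳ _ ⟩
      c * (length A′ + length B)        ≡⟨ cong (c *_) size ⟨
      c * length A                      ∎
      where
      lower : 2 * c + d * E A′ ≤ c * length A′ + 0
      lower = ≤-trans (proj₂ (ih A′ unique′ (lower-levels t A∈T)) (∈-filter⁺ (below? t) v₀ z≤n)
                                                                     (∈-filter⁺ (below? t) v₁ z≤n))
                      (≤-reflexive (sym (+-identityʳ _)))

  potential-bounds : ∀ t → PotentialBounds t
  potential-bounds zero = bounds-ground
  potential-bounds (suc t) = bounds-step t (potential-bounds t)

  ρ≥ : ∀ {A r} → 2 * c + d * pairCount (adj? k) A ≤ c * length A + r →
    + (2 * (k + 1) * (k ∸ 2)) - + r ℤ.≤ ρ k A
  ρ≥ {A} {r} bound = m+q≤p+n⇒m-n≤p-q {2 * (k + 1) * (k ∸ 2)} {r} {c * length A} {d * edgeCount k A}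
    (subst (_≤ c * length A + r) (cong₂ _+_ (sym (*-assoc 2 (k + 1) (k ∸ 2)))
                                            (cong (d *_) (sym (edgeCount≡pairCount k A)))) bound)

lemma4p1 : (k t : ℕ) → 4 ≤ k → 1 ≤ t →
    (A : List Vertex) → Unique A → All (InTower k t) A →
    (2 ≤ length A →
       + (2 * (k + 1) * (k ∸ 2)) - + (2 * (k ∸ 1)) ℤ.≤ ρ k A)
    × ((0 , 0) ∈ A → (0 , 1) ∈ A →
       + (2 * (k + 1) * (k ∸ 2)) ℤ.≤ ρ k A)
lemma4p1 (suc (suc (suc (suc n)))) t (s≤s (s≤s (s≤s (s≤s _)))) _ A unique A∈T =
  (λ 2≤A → ρ≥ {A} (proj₁ bounds 2≤A)) ,
  (λ v₀ v₁ → subst (ℤ._≤ ρ k A) (ℤ.+-identityʳ _)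
                   (ρ≥ {A} (≤-trans (proj₂ bounds v₀ v₁) (≤-reflexive (sym (+-identityʳ _))))))
  where
  open Tower n
  bounds = potential-bounds t A unique A∈T
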